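{- Let $n$ be a positive integer, let $V$ be a free $\mathbb{Z}/n\mathbb{Z}$-module of rank $2$, let $\Gamma$ be a subgroup of $\mathrm{Aut}(V)\cong\mathrm{GL}_2(\mathbb{Z}/n\mathbb{Z})$, and let $W$ be a $\mathbb{Z}/n\mathbb{Z}$-submodule of $V$ with $\Gamma W=W$. Let $I(\Gamma)=(\mathrm{Aut}(V):\Gamma)$ be the index of $\Gamma$ in $\mathrm{Aut}(V)$. Suppose that the restriction $\Gamma|_W$ is an abelian subgroup of $\mathrm{Aut}(W)$. Then \[ |W|\le I(\Gamma)^3.\] -}

module Defs where

open import Data.Nat using (ℕ; zero; suc; NonZero; _+_; _*_)
open import Data.Nat.DivMod using (_mod_; _/_)
open import Data.Fin using (Fin; toℕ; _≟_)
open import Data.Bool using (Bool; _∧_)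
open import Data.Product using (_×_; _,_)
open import Data.List using (List; length; filterᵇ; allFin; cartesianProductWith)
open import Data.Bool.ListAction using (any)
open import Relation.Nullary.Decidable using (⌊_⌋)

-- Z/nZ is represented by Fin n with arithmetic mod n.
module _ {n : ℕ} {{_ : NonZero n}} where

  _+ₙ_ : Fin n → Fin n → Fin n
  a +ₙ b = (toℕ a + toℕ b) mod n

  _*ₙ_ : Fin n → Fin n → Fin n
  a *ₙ b = (toℕ a * toℕ b) mod n

  0ₙ 1ₙ : Fin n
  0ₙ = 0 mod n
  1ₙ = 1 mod n

-- V = (Z/nZ)^2, the free Z/nZ-module of rank 2 (with its standard basis).
V : ℕ → Set
V n = Fin n × Fin n

-- 2x2 matrices over Z/nZ  ( a b ; c d ) = endomorphisms of V.
record Mat (n : ℕ) : Set where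
  constructor mat
  field
    a b c d : Fin n

module _ {n : ℕ} {{_ : NonZero n}} where

  zeroV : V n
  zeroV = 0ₙ , 0ₙ

  _+V_ : V n → V n → V n
  (x , y) +V (x' , y') = (x +ₙ x') , (y +ₙ y')

  _·V_ : Fin n → V n → V n
  s ·V (x , y) = (s *ₙ x) , (s *ₙ y)

  _⊙_ : Mat n → V n → V n
  mat a b c d ⊙ (x , y) = ((a *ₙ x) +ₙ (b *ₙ y)) , ((c *ₙ x) +ₙ (d *ₙ y))

  _⊗_ : Mat n → Mat n → Mat n
  mat a b c d ⊗ mat a' b' c' d' =
    mat ((a *ₙ a') +ₙ (b *ₙ c')) ((a *ₙ b') +ₙ (b *ₙ d'))
        ((c *ₙ a') +ₙ (d *ₙ c')) ((c *ₙ b') +ₙ (d *ₙ d'))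

  idM : Mat n
  idM = mat 1ₙ 0ₙ 0ₙ 1ₙ

allV : (n : ℕ) → List (V n)
allV n = cartesianProductWith _,_ (allFin n) (allFin n)

allMat : (n : ℕ) → List (Mat n)
allMat n = cartesianProductWith (λ { (a , b) (c , d) → mat a b c d }) (allV n) (allV n)

_==M_ : {n : ℕ} → Mat n → Mat n → Bool
mat a b c d ==M mat a' b' c' d' = ⌊ a ≟ a' ⌋ ∧ ⌊ b ≟ b' ⌋ ∧ ⌊ c ≟ c' ⌋ ∧ ⌊ d ≟ d' ⌋

isGL : {n : ℕ} {{_ : NonZero n}} → Mat n → Bool
isGL {n} M = any (λ M' → ((M ⊗ M') ==M idM) ∧ ((M' ⊗ M) ==M idM)) (allMat n)

card : {A : Set} → List A → (A → Bool) → ℕ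
card xs P = length (filterᵇ P xs)

-- index (G : H) = |G| / |H| for finite groups (exact by Lagrange);
-- the zero case never arises as H contains the identity.
indexℕ : ℕ → ℕ → ℕ
indexℕ g zero = zero
indexℕ g (suc h) = g / suc h

{-# OPTIONS --safe #-}
-- Let b be the least positive j such that the lower unitriangular matrix (1 0; j 1) lies in Γ,
-- let α be the least positive t such that t b annihilates W, and put m = α b.
-- The matrices (1 i; 0 1) (1 0; j 1) γ with i < α, j < b and γ ∈ Γ are pairwise distinct.
-- Indeed, if two of them coincide, some ρ ∈ Γ satisfies (1 0; j 1) ρ = (1 i'-i; 0 1) (1 0; j' 1);
-- as ρ commutes with (1 0; b 1) on W, a direct computation gives (i' - i) b W = 0, so i = i'
-- by minimality of α; then ρ = (1 0; j'-j 1), so j = j' by minimality of b.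
-- Hence m |Γ| ≤ |GL₂(ℤ/n)|, that is m ≤ I(Γ). On the other hand m W = 0, and the kernel of
-- multiplication by m on ℤ/n has at most m elements, so |W| ≤ m² ≤ I(Γ)³.
module Submission where

open import Algebra.Bundles using (CommutativeSemiring)
open import Algebra.Structures using (IsSemigroup)
open import Algebra.Structures.Biased using (isCommutativeMonoidˡ; IsCommutativeSemiringˡ)
open import Data.Bool using (Bool; true; _∧_)
open import Data.Bool.Properties as Bool using (T-≡)
open import Data.Fin as Fin using (Fin; toℕ; fromℕ<)
open import Data.Fin.Properties using (toℕ-fromℕ<; toℕ-injective; toℕ<n; injective⇒≤)
open import Data.List using (List; _∷_; []; length; lookup; map; _++_; cartesianProduct; filterᵇ; allFin)
open import Data.List.Properties using (length-++; length-map; length-tabulate)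
open import Data.List.Membership.Propositional using (_∈_; lose)
open import Data.List.Membership.Propositional.Properties
  using (∈-lookup; ∈-length; ∈-filter⁺; ∈-filter⁻; ∈-allFin; ∈-cartesianProductWith⁺; ∈-cartesianProduct⁺;
         ∈-cartesianProduct⁻)
import Data.List.Membership.Setoid.Properties as Membershipₛ
open import Data.List.Relation.Unary.All as All using ()
open import Data.List.Relation.Unary.AllPairs using (_∷_)
open import Data.List.Relation.Unary.Any using (index)
open import Data.List.Relation.Unary.Any.Properties using (any⁺)
open import Data.List.Relation.Unary.Unique.Propositional using (Unique)
import Data.List.Relation.Unary.Unique.Propositional.Properties as Unique
open import Data.Nat using (ℕ; zero; suc; NonZero; >-nonZero; >-nonZero⁻¹; _+_; _*_; _^_; _%_; _/_; _∸_; _≤_; _<_)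
open import Data.Nat.DivMod
  using (_mod_; %-distribˡ-+; %-distribˡ-*; m<n⇒m%n≡m; [m+n]%n≡m%n; m/n*n≡m; m<n*o⇒m/o<n; m*n/n≡m; /-monoˡ-≤)
open import Data.Nat.Divisibility using (_∣_; m%n≡0⇒n∣m)
open import Data.Nat.Properties
  using (_≟_; +-assoc; +-comm; *-assoc; *-comm; *-identityˡ; *-identityʳ; *-distribʳ-+; *-cancelˡ-≡; *-monoʳ-<;
         m*n≢0; m≤m*n; ^-monoˡ-≤; m+[n∸m]≡n; m∸n+n≡m; m∸n≤m; m∸n≡0⇒m≤n; <⇒≤; ≤-antisym; ≤-<-trans; ≤-total;
         m<1+n⇒m<n∨m≡n; n<1+n; n≢0⇒n>0; >⇒≢; module ≤-Reasoning)
open import Data.Product using (Σ; _×_; _,_; proj₁; proj₂)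
open import Data.Product.Properties using (≡-dec)
open import Data.Sum using (_⊎_; inj₁; inj₂; [_,_]′)
open import Function using (_∘_; id; Injective)
open import Function.Bundles using (Equivalence)
open import Relation.Nullary using (Dec; yes; no; contradiction)
open import Relation.Nullary.Decidable using (T?; map′; _→-dec_; dec-true; ⌊_⌋; isYes≗does)
open import Relation.Unary using (Decidable)
open import Relation.Binary.PropositionalEquality
  using (_≡_; refl; sym; trans; cong; cong₂; subst; isEquivalence; setoid; module ≡-Reasoning)

open import Defs

-- Least positive witnesses and counting

record LeastPositive (P : ℕ → Set) : Set where
  field
    value    : ℕ
    positive : 0 < value
    holds    : P value
    minimal  : ∀ {t} → t < value → P t → t ≡ 0

module _ {P : ℕ → Set} (P? : Decidable P) where

  private
    below-suc : ∀ {v} → (∀ {t} → t < v → P t → t ≡ 0) → (P v → v ≡ 0) →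
                ∀ {t} → t < suc v → P t → t ≡ 0
    below-suc below at-v t<1+v pt with m<1+n⇒m<n∨m≡n t<1+v
    ... | inj₁ t<v  = below t<v pt
    ... | inj₂ refl = at-v pt

    search : ∀ v → LeastPositive P ⊎ (∀ {t} → t < v → P t → t ≡ 0)
    search zero = inj₂ λ ()
    search (suc v) with search v
    ... | inj₁ least = inj₁ least
    ... | inj₂ below with P? v
    ...   | no ¬pv = inj₂ (below-suc below (λ pv → contradiction pv ¬pv))
    ...   | yes pv with v ≟ 0
    ...     | yes v≡0 = inj₂ (below-suc below (λ _ → v≡0))
    ...     | no v≢0  = inj₁ (record { value = v ; positive = n≢0⇒n>0 v≢0 ; holds = pv ; minimal = below })

  leastPositive : ∀ {m} → 0 < m → P m → LeastPositive P
  leastPositive {m} 0<m pm with search (suc m)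
  ... | inj₁ least = least
  ... | inj₂ below = contradiction (below (n<1+n m) pm) (>⇒≢ 0<m)

module _ {A : Set} where

  lookup-injective : ∀ {xs : List A} → Unique xs → ∀ {i j} → lookup xs i ≡ lookup xs j → i ≡ j
  lookup-injective (_    ∷ _)   {Fin.zero}  {Fin.zero}  _  = refl
  lookup-injective (x∉xs ∷ _)   {Fin.zero}  {Fin.suc j} eq = contradiction eq (All.lookup x∉xs (∈-lookup j))
  lookup-injective (x∉xs ∷ _)   {Fin.suc i} {Fin.zero}  eq = contradiction (sym eq) (All.lookup x∉xs (∈-lookup i))
  lookup-injective (_    ∷ xs!) {Fin.suc i} {Fin.suc j} eq = cong Fin.suc (lookup-injective xs! eq)

  module _ (p : A → Bool) {xs : List A} where

    ∈-filterᵇ⁺ : ∀ {x} → x ∈ xs → p x ≡ true → x ∈ filterᵇ p xs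
    ∈-filterᵇ⁺ x∈xs px = ∈-filter⁺ (T? ∘ p) x∈xs (Equivalence.from T-≡ px)

    ∈-filterᵇ⁻ : ∀ {x} → x ∈ filterᵇ p xs → p x ≡ true
    ∈-filterᵇ⁻ x∈ = Equivalence.to T-≡ (proj₂ (∈-filter⁻ (T? ∘ p) {xs = xs} x∈))

module _ {A B : Set} where

  injective⇒length≤ : ∀ {xs : List A} {ys : List B} (f : A → B) → Unique xs →
                      (∀ {x} → x ∈ xs → f x ∈ ys) →
                      (∀ {x y} → x ∈ xs → y ∈ xs → f x ≡ f y → x ≡ y) →
                      length xs ≤ length ys
  injective⇒length≤ {xs} {ys} f xs! f∈ys f-injective = injective⇒≤ position-injective
    where
    position : Fin (length xs) → Fin (length ys)
    position i = index (f∈ys (∈-lookup i))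

    position-injective : Injective _≡_ _≡_ position
    position-injective {i} {j} eq = lookup-injective xs! (f-injective (∈-lookup i) (∈-lookup j)
      (Membershipₛ.index-injective (setoid B) (f∈ys (∈-lookup i)) (f∈ys (∈-lookup j)) eq))

  length-cartesianProduct : ∀ (xs : List A) (ys : List B) →
                            length (cartesianProduct xs ys) ≡ length xs * length ys
  length-cartesianProduct []       ys = refl
  length-cartesianProduct (x ∷ xs) ys = begin
    length (map (x ,_) ys ++ cartesianProduct xs ys)          ≡⟨ length-++ (map (x ,_) ys) ⟩
    length (map (x ,_) ys) + length (cartesianProduct xs ys)  ≡⟨ cong₂ _+_ (length-map (x ,_) ys)
                                                                             (length-cartesianProduct xs ys) ⟩
    length ys + length xs * length ys                         ∎
    where open ≡-Reasoning

length-allFin : ∀ k → length (allFin k) ≡ k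
length-allFin k = length-tabulate id

≤-indexℕ : ∀ k {g h} → k * h ≤ g → 0 < h → k ≤ indexℕ g h
≤-indexℕ k {g} {suc h} kh≤g _ = subst (_≤ g / suc h) (m*n/n≡m k (suc h)) (/-monoˡ-≤ (suc h) kh≤g)

k*k≤k^3 : ∀ k .{{_ : NonZero k}} → k * k ≤ k ^ 3
k*k≤k^3 k = subst (k * k ≤_) (trans (*-assoc k k k) (cong (λ z → k * (k * z)) (sym (*-identityʳ k))))
                  (m≤m*n (k * k) k)

module _ {n : ℕ} {{_ : NonZero n}} where

  -- The ring ℤ/nℤ

  [_] : ℕ → Fin n
  [ x ] = x mod n

  toℕ-[] : ∀ x → toℕ [ x ] ≡ x % n
  toℕ-[] x = toℕ-fromℕ< _

  []-toℕ : ∀ (a : Fin n) → [ toℕ a ] ≡ a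
  []-toℕ a = toℕ-injective (trans (toℕ-[] (toℕ a)) (m<n⇒m%n≡m (toℕ<n a)))

  []-elim : {P : Fin n → Set} → (∀ x → P [ x ]) → ∀ a → P a
  []-elim {P} p a = subst P ([]-toℕ a) (p (toℕ a))

  []-+ : ∀ x y → [ x + y ] ≡ [ x ] +ₙ [ y ]
  []-+ x y = toℕ-injective (begin
    toℕ [ x + y ]                ≡⟨ toℕ-[] (x + y) ⟩
    (x + y) % n                  ≡⟨ %-distribˡ-+ x y n ⟩
    (x % n + y % n) % n          ≡⟨ cong₂ (λ p q → (p + q) % n) (toℕ-[] x) (toℕ-[] y) ⟨
    (toℕ [ x ] + toℕ [ y ]) % n  ≡⟨ toℕ-[] _ ⟨
    toℕ ([ x ] +ₙ [ y ])         ∎)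
    where open ≡-Reasoning

  []-* : ∀ x y → [ x * y ] ≡ [ x ] *ₙ [ y ]
  []-* x y = toℕ-injective (begin
    toℕ [ x * y ]                ≡⟨ toℕ-[] (x * y) ⟩
    (x * y) % n                  ≡⟨ %-distribˡ-* x y n ⟩
    (x % n * (y % n)) % n        ≡⟨ cong₂ (λ p q → (p * q) % n) (toℕ-[] x) (toℕ-[] y) ⟨
    (toℕ [ x ] * toℕ [ y ]) % n  ≡⟨ toℕ-[] _ ⟨
    toℕ ([ x ] *ₙ [ y ])         ∎)
    where open ≡-Reasoning

  []-∸ : ∀ {x y} → x ≤ y → [ y ] ≡ [ x ] +ₙ [ y ∸ x ]
  []-∸ {x} {y} x≤y = trans (cong [_] (sym (m+[n∸m]≡n x≤y))) ([]-+ x (y ∸ x))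

  [n]≡0ₙ : [ n ] ≡ 0ₙ
  [n]≡0ₙ = toℕ-injective (trans (toℕ-[] n) (trans ([m+n]%n≡m%n 0 n) (sym (toℕ-[] 0))))

  toℕ-0ₙ : toℕ (0ₙ {n}) ≡ 0
  toℕ-0ₙ = trans (toℕ-[] 0) (m<n⇒m%n≡m (>-nonZero⁻¹ n))

  [x]≡0ₙ⇒n∣x : ∀ {x} → [ x ] ≡ 0ₙ → n ∣ x
  [x]≡0ₙ⇒n∣x {x} eq = m%n≡0⇒n∣m x n (trans (sym (toℕ-[] x)) (trans (cong toℕ eq) toℕ-0ₙ))

  +ₙ-assoc : ∀ a b c → (a +ₙ b) +ₙ c ≡ a +ₙ (b +ₙ c)
  +ₙ-assoc = []-elim λ x → []-elim λ y → []-elim λ z → begin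
    ([ x ] +ₙ [ y ]) +ₙ [ z ]  ≡⟨ trans ([]-+ (x + y) z) (cong (_+ₙ [ z ]) ([]-+ x y)) ⟨
    [ (x + y) + z ]            ≡⟨ cong [_] (+-assoc x y z) ⟩
    [ x + (y + z) ]            ≡⟨ trans ([]-+ x (y + z)) (cong ([ x ] +ₙ_) ([]-+ y z)) ⟩
    [ x ] +ₙ ([ y ] +ₙ [ z ])  ∎
    where open ≡-Reasoning

  *ₙ-assoc : ∀ a b c → (a *ₙ b) *ₙ c ≡ a *ₙ (b *ₙ c)
  *ₙ-assoc = []-elim λ x → []-elim λ y → []-elim λ z → begin
    ([ x ] *ₙ [ y ]) *ₙ [ z ]  ≡⟨ trans ([]-* (x * y) z) (cong (_*ₙ [ z ]) ([]-* x y)) ⟨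
    [ (x * y) * z ]            ≡⟨ cong [_] (*-assoc x y z) ⟩
    [ x * (y * z) ]            ≡⟨ trans ([]-* x (y * z)) (cong ([ x ] *ₙ_) ([]-* y z)) ⟩
    [ x ] *ₙ ([ y ] *ₙ [ z ])  ∎
    where open ≡-Reasoning

  *ₙ-distribʳ-+ₙ : ∀ c a b → (a +ₙ b) *ₙ c ≡ (a *ₙ c) +ₙ (b *ₙ c)
  *ₙ-distribʳ-+ₙ = []-elim λ z → []-elim λ x → []-elim λ y → begin
    ([ x ] +ₙ [ y ]) *ₙ [ z ]             ≡⟨ trans ([]-* (x + y) z) (cong (_*ₙ [ z ]) ([]-+ x y)) ⟨
    [ (x + y) * z ]                       ≡⟨ cong [_] (*-distribʳ-+ z x y) ⟩
    [ x * z + y * z ]                     ≡⟨ trans ([]-+ (x * z) (y * z)) (cong₂ _+ₙ_ ([]-* x z) ([]-* y z)) ⟩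
    ([ x ] *ₙ [ z ]) +ₙ ([ y ] *ₙ [ z ])  ∎
    where open ≡-Reasoning

  +ₙ-*ₙ-isCommutativeSemiringˡ : IsCommutativeSemiringˡ {A = Fin n} _≡_ _+ₙ_ _*ₙ_ 0ₙ 1ₙ
  +ₙ-*ₙ-isCommutativeSemiringˡ = record
    { +-isCommutativeMonoid = isCommutativeMonoidˡ record
      { isSemigroup = semigroup _+ₙ_ +ₙ-assoc
      ; identityˡ   = []-elim λ x → sym ([]-+ 0 x)
      ; comm        = []-elim λ x → []-elim λ y → trans (sym ([]-+ x y)) (trans (cong [_] (+-comm x y)) ([]-+ y x))
      }
    ; *-isCommutativeMonoid = isCommutativeMonoidˡ record
      { isSemigroup = semigroup _*ₙ_ *ₙ-assoc
      ; identityˡ   = []-elim λ x → trans (sym ([]-* 1 x)) (cong [_] (*-identityˡ x))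
      ; comm        = []-elim λ x → []-elim λ y → trans (sym ([]-* x y)) (trans (cong [_] (*-comm x y)) ([]-* y x))
      }
    ; distribʳ = *ₙ-distribʳ-+ₙ
    ; zeroˡ    = []-elim λ x → sym ([]-* 0 x)
    }
    where
    semigroup : ∀ _∙_ → (∀ a b c → (a ∙ b) ∙ c ≡ a ∙ (b ∙ c)) → IsSemigroup _≡_ _∙_
    semigroup _∙_ assoc = record
      { isMagma = record { isEquivalence = isEquivalence ; ∙-cong = cong₂ _∙_ } ; assoc = assoc }

  +ₙ-*ₙ-commutativeSemiring : CommutativeSemiring _ _
  +ₙ-*ₙ-commutativeSemiring = record
    { isCommutativeSemiring = IsCommutativeSemiringˡ.isCommutativeSemiring +ₙ-*ₙ-isCommutativeSemiringˡ }

  private module ℤₙ = CommutativeSemiring +ₙ-*ₙ-commutativeSemiring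
  open import Algebra.Solver.Ring.NaturalCoefficients.Default +ₙ-*ₙ-commutativeSemiring
    using (solve; _:=_; _:+_; _:*_; con)

  [n*x]≡0ₙ : ∀ x → [ n * x ] ≡ 0ₙ
  [n*x]≡0ₙ x = trans ([]-* n x) (trans (cong (_*ₙ [ x ]) [n]≡0ₙ) (ℤₙ.zeroˡ [ x ]))

  infix 8 -ₙ_
  -ₙ_ : Fin n → Fin n
  -ₙ a = [ n ∸ toℕ a ]

  +ₙ-inverseˡ : ∀ a → (-ₙ a) +ₙ a ≡ 0ₙ
  +ₙ-inverseˡ a = begin
    (-ₙ a) +ₙ a                 ≡⟨ cong ((-ₙ a) +ₙ_) ([]-toℕ a) ⟨
    [ n ∸ toℕ a ] +ₙ [ toℕ a ]  ≡⟨ []-+ (n ∸ toℕ a) (toℕ a) ⟨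
    [ (n ∸ toℕ a) + toℕ a ]     ≡⟨ cong [_] (m∸n+n≡m (<⇒≤ (toℕ<n a))) ⟩
    [ n ]                       ≡⟨ [n]≡0ₙ ⟩
    0ₙ                          ∎
    where open ≡-Reasoning

  +ₙ-inverseʳ : ∀ a → a +ₙ (-ₙ a) ≡ 0ₙ
  +ₙ-inverseʳ a = trans (ℤₙ.+-comm a (-ₙ a)) (+ₙ-inverseˡ a)

  +ₙ-identityʳ-unique : ∀ a b → a +ₙ b ≡ a → b ≡ 0ₙ
  +ₙ-identityʳ-unique a b eq = begin
    b                   ≡⟨ ℤₙ.+-identityˡ b ⟨
    0ₙ +ₙ b             ≡⟨ cong (_+ₙ b) (+ₙ-inverseˡ a) ⟨
    ((-ₙ a) +ₙ a) +ₙ b  ≡⟨ +ₙ-assoc (-ₙ a) a b ⟩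
    (-ₙ a) +ₙ (a +ₙ b)  ≡⟨ cong ((-ₙ a) +ₙ_) eq ⟩
    (-ₙ a) +ₙ a         ≡⟨ +ₙ-inverseˡ a ⟩
    0ₙ                  ∎
    where open ≡-Reasoning

  kernel-code : ∀ m .{{_ : NonZero m}} → Fin n → Fin m
  kernel-code m x = fromℕ< (m<n*o⇒m/o<n (*-monoʳ-< m (toℕ<n x)))

  -- m x is a multiple of n, so it is recovered from ⌊m x / n⌋
  kernel-code-injective : ∀ m .{{_ : NonZero m}} {x y : Fin n} → [ m ] *ₙ x ≡ 0ₙ → [ m ] *ₙ y ≡ 0ₙ →
                          kernel-code m x ≡ kernel-code m y → x ≡ y
  kernel-code-injective m {x} {y} mx≡0 my≡0 eq = toℕ-injective (*-cancelˡ-≡ (toℕ x) (toℕ y) m (begin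
    m * toℕ x            ≡⟨ m/n*n≡m (n∣m* mx≡0) ⟨
    (m * toℕ x) / n * n  ≡⟨ cong (_* n) (trans (sym (toℕ-fromℕ< _)) (trans (cong toℕ eq) (toℕ-fromℕ< _))) ⟩
    (m * toℕ y) / n * n  ≡⟨ m/n*n≡m (n∣m* my≡0) ⟩
    m * toℕ y            ∎))
    where
    open ≡-Reasoning
    n∣m* : ∀ {z} → [ m ] *ₙ z ≡ 0ₙ → n ∣ m * toℕ z
    n∣m* {z} mz≡0 = [x]≡0ₙ⇒n∣x (trans ([]-* m (toℕ z)) (trans (cong ([ m ] *ₙ_) ([]-toℕ z)) mz≡0))

  -- 2 × 2 matrices over ℤ/nℤ

  mat-cong : ∀ {a b c d a' b' c' d' : Fin n} →
             a ≡ a' → b ≡ b' → c ≡ c' → d ≡ d' → mat a b c d ≡ mat a' b' c' d'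
  mat-cong refl refl refl refl = refl

  entry-assoc : ∀ (a b a' b' c' d' x y : Fin n) →
    (((a *ₙ a') +ₙ (b *ₙ c')) *ₙ x) +ₙ (((a *ₙ b') +ₙ (b *ₙ d')) *ₙ y)
      ≡ (a *ₙ ((a' *ₙ x) +ₙ (b' *ₙ y))) +ₙ (b *ₙ ((c' *ₙ x) +ₙ (d' *ₙ y)))
  entry-assoc = solve 8 (λ a b a' b' c' d' x y →
    (a :* a' :+ b :* c') :* x :+ (a :* b' :+ b :* d') :* y
      := a :* (a' :* x :+ b' :* y) :+ b :* (c' :* x :+ d' :* y)) refl

  1x+0y≡x : ∀ (x y : Fin n) → (1ₙ *ₙ x) +ₙ (0ₙ *ₙ y) ≡ x
  1x+0y≡x = solve 2 (λ x y → con 1 :* x :+ con 0 :* y := x) refl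

  0x+1y≡y : ∀ (x y : Fin n) → (0ₙ *ₙ x) +ₙ (1ₙ *ₙ y) ≡ y
  0x+1y≡y = solve 2 (λ x y → con 0 :* x :+ con 1 :* y := y) refl

  x1+y0≡x : ∀ (x y : Fin n) → (x *ₙ 1ₙ) +ₙ (y *ₙ 0ₙ) ≡ x
  x1+y0≡x = solve 2 (λ x y → x :* con 1 :+ y :* con 0 := x) refl

  x0+y1≡y : ∀ (x y : Fin n) → (x *ₙ 0ₙ) +ₙ (y *ₙ 1ₙ) ≡ y
  x0+y1≡y = solve 2 (λ x y → x :* con 0 :+ y :* con 1 := y) refl

  ⊗-assoc : ∀ (L M N : Mat n) → (L ⊗ M) ⊗ N ≡ L ⊗ (M ⊗ N)
  ⊗-assoc (mat a b c d) (mat a' b' c' d') (mat a'' b'' c'' d'') = mat-cong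
    (entry-assoc a b a' b' c' d' a'' c'') (entry-assoc a b a' b' c' d' b'' d'')
    (entry-assoc c d a' b' c' d' a'' c'') (entry-assoc c d a' b' c' d' b'' d'')

  ⊗-identityˡ : ∀ M → idM ⊗ M ≡ M
  ⊗-identityˡ (mat a b c d) = mat-cong (1x+0y≡x a c) (1x+0y≡x b d) (0x+1y≡y a c) (0x+1y≡y b d)

  ⊗-identityʳ : ∀ M → M ⊗ idM ≡ M
  ⊗-identityʳ (mat a b c d) = mat-cong (x1+y0≡x a b) (x0+y1≡y a b) (x1+y0≡x c d) (x0+y1≡y c d)

  ⊙-⊗ : ∀ (M N : Mat n) v → (M ⊗ N) ⊙ v ≡ M ⊙ (N ⊙ v)
  ⊙-⊗ (mat a b c d) (mat a' b' c' d') (x , y) =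
    cong₂ _,_ (entry-assoc a b a' b' c' d' x y) (entry-assoc c d a' b' c' d' x y)

  ⊙-identity : ∀ v → idM ⊙ v ≡ v
  ⊙-identity (x , y) = cong₂ _,_ (1x+0y≡x x y) (0x+1y≡y x y)

  ⊙-·V : ∀ M s v → M ⊙ (s ·V v) ≡ s ·V (M ⊙ v)
  ⊙-·V (mat a b c d) s (x , y) = cong₂ _,_ (entry a b) (entry c d)
    where
    entry : ∀ a b → (a *ₙ (s *ₙ x)) +ₙ (b *ₙ (s *ₙ y)) ≡ s *ₙ ((a *ₙ x) +ₙ (b *ₙ y))
    entry a b = solve 5 (λ a b s x y → a :* (s :* x) :+ b :* (s :* y) := s :* (a :* x :+ b :* y)) refl a b s x y

  ⊙-zeroV : ∀ M → M ⊙ zeroV ≡ zeroV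
  ⊙-zeroV (mat a b c d) = cong₂ _,_ (entry a b) (entry c d)
    where
    entry : ∀ a b → (a *ₙ 0ₙ) +ₙ (b *ₙ 0ₙ) ≡ 0ₙ
    entry = solve 2 (λ a b → a :* con 0 :+ b :* con 0 := con 0) refl

  0ₙ-·V : ∀ v → 0ₙ ·V v ≡ zeroV
  0ₙ-·V (x , y) = cong₂ _,_ (ℤₙ.zeroˡ x) (ℤₙ.zeroˡ y)

  Invertible : Mat n → Set
  Invertible M = Σ (Mat n) λ M' → (M ⊗ M' ≡ idM) × (M' ⊗ M ≡ idM)

  ⊗-cancelˡ : ∀ {P X Y} → Invertible P → P ⊗ X ≡ P ⊗ Y → X ≡ Y
  ⊗-cancelˡ {P} {X} {Y} (P' , _ , P'P≡id) eq = begin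
    X             ≡⟨ ⊗-identityˡ X ⟨
    idM ⊗ X       ≡⟨ cong (_⊗ X) P'P≡id ⟨
    (P' ⊗ P) ⊗ X  ≡⟨ ⊗-assoc P' P X ⟩
    P' ⊗ (P ⊗ X)  ≡⟨ cong (P' ⊗_) eq ⟩
    P' ⊗ (P ⊗ Y)  ≡⟨ ⊗-assoc P' P Y ⟨
    (P' ⊗ P) ⊗ Y  ≡⟨ cong (_⊗ Y) P'P≡id ⟩
    idM ⊗ Y       ≡⟨ ⊗-identityˡ Y ⟩
    Y             ∎
    where open ≡-Reasoning

  ⊙-cancelˡ : ∀ {P u v} → Invertible P → P ⊙ u ≡ P ⊙ v → u ≡ v
  ⊙-cancelˡ {P} {u} {v} (P' , _ , P'P≡id) eq = begin
    u             ≡⟨ ⊙-identity u ⟨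
    idM ⊙ u       ≡⟨ cong (_⊙ u) P'P≡id ⟨
    (P' ⊗ P) ⊙ u  ≡⟨ ⊙-⊗ P' P u ⟩
    P' ⊙ (P ⊙ u)  ≡⟨ cong (P' ⊙_) eq ⟩
    P' ⊙ (P ⊙ v)  ≡⟨ ⊙-⊗ P' P v ⟨
    (P' ⊗ P) ⊙ v  ≡⟨ cong (_⊙ v) P'P≡id ⟩
    idM ⊙ v       ≡⟨ ⊙-identity v ⟩
    v             ∎
    where open ≡-Reasoning

  ⊗-invertible : ∀ {P Q} → Invertible P → Invertible Q → Invertible (P ⊗ Q)
  ⊗-invertible {P} {Q} (P' , PP'≡id , P'P≡id) (Q' , QQ'≡id , Q'Q≡id) =
    Q' ⊗ P' , cancel-middle P Q Q' P' QQ'≡id PP'≡id , cancel-middle Q' P' P Q P'P≡id Q'Q≡id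
    where
    cancel-middle : ∀ A B C D → B ⊗ C ≡ idM → A ⊗ D ≡ idM → (A ⊗ B) ⊗ (C ⊗ D) ≡ idM
    cancel-middle A B C D BC≡id AD≡id = begin
      (A ⊗ B) ⊗ (C ⊗ D)  ≡⟨ ⊗-assoc A B (C ⊗ D) ⟩
      A ⊗ (B ⊗ (C ⊗ D))  ≡⟨ cong (A ⊗_) (⊗-assoc B C D) ⟨
      A ⊗ ((B ⊗ C) ⊗ D)  ≡⟨ cong (λ M → A ⊗ (M ⊗ D)) BC≡id ⟩
      A ⊗ (idM ⊗ D)      ≡⟨ cong (A ⊗_) (⊗-identityˡ D) ⟩
      A ⊗ D              ≡⟨ AD≡id ⟩
      idM                ∎
      where open ≡-Reasoning

  annihilated-⊙ : ∀ {P s w} → Invertible P → s ·V (P ⊙ w) ≡ zeroV → s ·V w ≡ zeroV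
  annihilated-⊙ {P} {s} {w} P-invertible eq = ⊙-cancelˡ P-invertible (begin
    P ⊙ (s ·V w)  ≡⟨ ⊙-·V P s w ⟩
    s ·V (P ⊙ w)  ≡⟨ eq ⟩
    zeroV         ≡⟨ ⊙-zeroV P ⟨
    P ⊙ zeroV     ∎)
    where open ≡-Reasoning

  ⌊x≟x⌋≡true : ∀ (x : Fin n) → ⌊ x Fin.≟ x ⌋ ≡ true
  ⌊x≟x⌋≡true x = trans (isYes≗does (x Fin.≟ x)) (dec-true (x Fin.≟ x) refl)

  ==M-refl : ∀ (M : Mat n) → (M ==M M) ≡ true
  ==M-refl (mat a b c d) rewrite ⌊x≟x⌋≡true a | ⌊x≟x⌋≡true b | ⌊x≟x⌋≡true c | ⌊x≟x⌋≡true d = refl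

  ∈-allV : ∀ v → v ∈ allV n
  ∈-allV (x , y) = ∈-cartesianProductWith⁺ _,_ (∈-allFin x) (∈-allFin y)

  ∈-allMat : ∀ M → M ∈ allMat n
  ∈-allMat (mat a b c d) = ∈-cartesianProductWith⁺ _ (∈-allV (a , b)) (∈-allV (c , d))

  allV-unique : Unique (allV n)
  allV-unique = Unique.cartesianProductWith⁺ _,_ (λ { refl → refl , refl }) (Unique.allFin⁺ n) (Unique.allFin⁺ n)

  allMat-unique : Unique (allMat n)
  allMat-unique = Unique.cartesianProductWith⁺ _
    (λ { {_ , _} {_ , _} {_ , _} {_ , _} refl → refl , refl }) allV-unique allV-unique

  invertible⇒isGL : ∀ {M} → Invertible M → isGL M ≡ true
  invertible⇒isGL {M} (M' , MM'≡id , M'M≡id) =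
    Equivalence.to T-≡ (any⁺ _ (lose (∈-allMat M') (Equivalence.from T-≡ M'-inverse)))
    where
    M'-inverse : ((M ⊗ M') ==M idM) ∧ ((M' ⊗ M) ==M idM) ≡ true
    M'-inverse = trans (cong₂ (λ A B → (A ==M idM) ∧ (B ==M idM)) MM'≡id M'M≡id)
                       (cong₂ _∧_ (==M-refl idM) (==M-refl idM))

  ∀V? : ∀ {P : V n → Set} → Decidable P → Dec (∀ v → P v)
  ∀V? P? = map′ (λ all v → All.lookup all (∈-allV v)) (λ p → All.tabulate (λ {v} _ → p v)) (All.all? P? (allV n))

  upper lower : Fin n → Mat n
  upper t = mat 1ₙ t 0ₙ 1ₙ
  lower t = mat 1ₙ 0ₙ t 1ₙ

  upper-+ : ∀ s t → upper s ⊗ upper t ≡ upper (s +ₙ t)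
  upper-+ s t = mat-cong (x1+y0≡x 1ₙ s) (solve 2 (λ s t → con 1 :* t :+ s :* con 1 := s :+ t) refl s t)
                         (x1+y0≡x 0ₙ 1ₙ) (0x+1y≡y t 1ₙ)

  lower-+ : ∀ s t → lower s ⊗ lower t ≡ lower (s +ₙ t)
  lower-+ s t = mat-cong (1x+0y≡x 1ₙ t) (1x+0y≡x 0ₙ 1ₙ)
                         (solve 2 (λ s t → s :* con 1 :+ con 1 :* t := s :+ t) refl s t) (x0+y1≡y s 1ₙ)

  upper-invertible : ∀ t → Invertible (upper t)
  upper-invertible t = upper (-ₙ t)
    , trans (upper-+ t (-ₙ t)) (cong upper (+ₙ-inverseʳ t))
    , trans (upper-+ (-ₙ t) t) (cong upper (+ₙ-inverseˡ t))

  lower-invertible : ∀ t → Invertible (lower t)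
  lower-invertible t = lower (-ₙ t)
    , trans (lower-+ t (-ₙ t)) (cong lower (+ₙ-inverseʳ t))
    , trans (lower-+ (-ₙ t) t) (cong lower (+ₙ-inverseˡ t))

  upper-⊙ : ∀ t x y → upper t ⊙ (x , y) ≡ (x +ₙ (t *ₙ y) , y)
  upper-⊙ t x y = cong₂ _,_ (solve 3 (λ t x y → con 1 :* x :+ t :* y := x :+ t :* y) refl t x y) (0x+1y≡y x y)

  lower-⊙ : ∀ t x y → lower t ⊙ (x , y) ≡ (x , (t *ₙ x) +ₙ y)
  lower-⊙ t x y = cong₂ _,_ (1x+0y≡x x y) (solve 3 (λ t x y → t :* x :+ con 1 :* y := t :* x :+ y) refl t x y)

  lower-⊙-comm : ∀ s t v → lower s ⊙ (lower t ⊙ v) ≡ lower t ⊙ (lower s ⊙ v)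
  lower-⊙-comm s t v = begin
    lower s ⊙ (lower t ⊙ v)  ≡⟨ ⊙-⊗ (lower s) (lower t) v ⟨
    (lower s ⊗ lower t) ⊙ v  ≡⟨ cong (_⊙ v) (trans (lower-+ s t)
                                   (trans (cong lower (ℤₙ.+-comm s t)) (sym (lower-+ t s)))) ⟩
    (lower t ⊗ lower s) ⊙ v  ≡⟨ ⊙-⊗ (lower t) (lower s) v ⟩
    lower t ⊙ (lower s ⊙ v)  ∎
    where open ≡-Reasoning

  upper-lower-commute⇒annihilated : ∀ d c v →
    upper d ⊙ (lower c ⊙ v) ≡ lower c ⊙ (upper d ⊙ v) → (d *ₙ c) ·V v ≡ zeroV
  upper-lower-commute⇒annihilated d c (x , y) eq = cong₂ _,_
    (+ₙ-identityʳ-unique _ _ (trans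
      (solve 4 (λ x y c d → (x :+ d :* y) :+ d :* c :* x := x :+ d :* (c :* x :+ y)) refl x y c d)
      (cong proj₁ eq′)))
    (+ₙ-identityʳ-unique _ _ (trans
      (solve 4 (λ x y c d → (c :* x :+ y) :+ d :* c :* y := c :* (x :+ d :* y) :+ y) refl x y c d)
      (sym (cong proj₂ eq′))))
    where
    open ≡-Reasoning
    eq′ : (x +ₙ (d *ₙ ((c *ₙ x) +ₙ y)) , (c *ₙ x) +ₙ y) ≡ (x +ₙ (d *ₙ y) , (c *ₙ (x +ₙ (d *ₙ y))) +ₙ y)
    eq′ = begin
      (x +ₙ (d *ₙ ((c *ₙ x) +ₙ y)) , (c *ₙ x) +ₙ y)  ≡⟨ upper-⊙ d x ((c *ₙ x) +ₙ y) ⟨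
      upper d ⊙ (x , (c *ₙ x) +ₙ y)                  ≡⟨ cong (upper d ⊙_) (lower-⊙ c x y) ⟨
      upper d ⊙ (lower c ⊙ (x , y))                  ≡⟨ eq ⟩
      lower c ⊙ (upper d ⊙ (x , y))                  ≡⟨ cong (lower c ⊙_) (upper-⊙ d x y) ⟩
      lower c ⊙ (x +ₙ (d *ₙ y) , y)                  ≡⟨ lower-⊙ c (x +ₙ (d *ₙ y)) y ⟩
      (x +ₙ (d *ₙ y) , (c *ₙ (x +ₙ (d *ₙ y))) +ₙ y)  ∎

  -- Up to lower unitriangular factors, which commute with lower c, ρ is upper d.
  commutes-with-lower⇒annihilated : ∀ ρ c d t t' w →
    lower t ⊗ ρ ≡ upper d ⊗ lower t' → ρ ⊙ (lower c ⊙ w) ≡ lower c ⊙ (ρ ⊙ w) → (d *ₙ c) ·V w ≡ zeroV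
  commutes-with-lower⇒annihilated ρ c d t t' w ρ-form ρ-comm =
    annihilated-⊙ {s = d *ₙ c} (lower-invertible t') (upper-lower-commute⇒annihilated d c (lower t' ⊙ w) (begin
      upper d ⊙ (lower c ⊙ (lower t' ⊙ w))  ≡⟨ cong (upper d ⊙_) (lower-⊙-comm c t' w) ⟩
      upper d ⊙ (lower t' ⊙ (lower c ⊙ w))  ≡⟨ ⊙-⊗ (upper d) (lower t') _ ⟨
      (upper d ⊗ lower t') ⊙ (lower c ⊙ w)  ≡⟨ cong (_⊙ (lower c ⊙ w)) ρ-form ⟨
      (lower t ⊗ ρ) ⊙ (lower c ⊙ w)         ≡⟨ ⊙-⊗ (lower t) ρ _ ⟩
      lower t ⊙ (ρ ⊙ (lower c ⊙ w))         ≡⟨ cong (lower t ⊙_) ρ-comm ⟩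
      lower t ⊙ (lower c ⊙ (ρ ⊙ w))         ≡⟨ lower-⊙-comm t c (ρ ⊙ w) ⟩
      lower c ⊙ (lower t ⊙ (ρ ⊙ w))         ≡⟨ cong (lower c ⊙_) (⊙-⊗ (lower t) ρ w) ⟨
      lower c ⊙ ((lower t ⊗ ρ) ⊙ w)         ≡⟨ cong (λ M → lower c ⊙ (M ⊙ w)) ρ-form ⟩
      lower c ⊙ ((upper d ⊗ lower t') ⊙ w)  ≡⟨ cong (lower c ⊙_) (⊙-⊗ (upper d) (lower t') w) ⟩
      lower c ⊙ (upper d ⊙ (lower t' ⊙ w))  ∎))
    where open ≡-Reasoning

  transvect : Fin n → Fin n → Mat n → Mat n
  transvect s t γ = upper s ⊗ (lower t ⊗ γ)

  transvect-⊗ : ∀ s t γ δ → transvect s t γ ⊗ δ ≡ transvect s t (γ ⊗ δ)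
  transvect-⊗ s t γ δ = trans (⊗-assoc (upper s) (lower t ⊗ γ) δ) (cong (upper s ⊗_) (⊗-assoc (lower t) γ δ))

  transvect-invertible : ∀ s t {γ} → Invertible γ → Invertible (transvect s t γ)
  transvect-invertible s t γ-invertible =
    ⊗-invertible (upper-invertible s) (⊗-invertible (lower-invertible t) γ-invertible)

  Annihilates : (W : V n → Bool) → Fin n → Set
  Annihilates W s = ∀ w → W w ≡ true → s ·V w ≡ zeroV

  annihilates? : ∀ W → Decidable (Annihilates W)
  annihilates? W s = ∀V? λ w → (W w Bool.≟ true) →-dec ≡-dec Fin._≟_ Fin._≟_ (s ·V w) zeroV

  least-lower∈Γ : ∀ (Γ : Mat n → Bool) → Γ idM ≡ true → LeastPositive (λ j → Γ (lower [ j ]) ≡ true)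
  least-lower∈Γ Γ Γ-id = leastPositive (λ j → Γ (lower [ j ]) Bool.≟ true) (>-nonZero⁻¹ n)
    (subst (λ t → Γ (lower t) ≡ true) (sym [n]≡0ₙ) Γ-id)

  least-annihilator : ∀ W b → LeastPositive (λ t → Annihilates W [ t * b ])
  least-annihilator W b = leastPositive (λ t → annihilates? W [ t * b ]) (>-nonZero⁻¹ n) nb-annihilates
    where
    nb-annihilates : Annihilates W [ n * b ]
    nb-annihilates w _ = subst (λ s → s ·V w ≡ zeroV) (sym ([n*x]≡0ₙ b)) (0ₙ-·V w)

-- b and α enter as parameters so that they stay opaque: unfolding the search that computes them is
-- prohibitively expensive for the type checker.
module Transvections {n : ℕ} {{_ : NonZero n}}
  (Γ : Mat n → Bool)
  (Γ-id : Γ idM ≡ true)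
  (Γ-⊗ : ∀ g h → Γ g ≡ true → Γ h ≡ true → Γ (g ⊗ h) ≡ true)
  (Γ-inverse : ∀ g → Γ g ≡ true → Σ (Mat n) (λ g' → (Γ g' ≡ true) × ((g ⊗ g') ≡ idM) × ((g' ⊗ g) ≡ idM)))
  (W : V n → Bool)
  (Γ-commute : ∀ g h w → Γ g ≡ true → Γ h ≡ true → W w ≡ true → g ⊙ (h ⊙ w) ≡ h ⊙ (g ⊙ w))
  (least-lower : LeastPositive (λ j → Γ (lower [ j ]) ≡ true))
  (least-annihilator : LeastPositive (λ t → Annihilates W [ t * LeastPositive.value least-lower ]))
  where

  open LeastPositive least-lower
    renaming (value to b; positive to b-positive; holds to lower-b∈Γ; minimal to b-minimal)
  open LeastPositive least-annihilator
    renaming (value to α; positive to α-positive; holds to αb-annihilates; minimal to α-minimal)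

  m : ℕ
  m = α * b

  instance
    m-nonZero : NonZero m
    m-nonZero = m*n≢0 α b {{>-nonZero α-positive}} {{>-nonZero b-positive}}

  record Quotient (s t s' t' : Fin n) : Set where
    field
      ρ    : Mat n
      ρ∈Γ  : Γ ρ ≡ true
      ρ-eq : upper s ⊗ (lower t ⊗ ρ) ≡ upper s' ⊗ lower t'

  quotient∈Γ : ∀ s t s' t' {γ γ'} → Γ γ ≡ true → Γ γ' ≡ true →
               transvect s t γ ≡ transvect s' t' γ' → Quotient s t s' t'
  quotient∈Γ s t s' t' {γ} {γ'} γ∈Γ γ'∈Γ eq with Γ-inverse γ' γ'∈Γ
  ... | δ , δ∈Γ , γ'δ≡id , _ = record { ρ = γ ⊗ δ ; ρ∈Γ = Γ-⊗ γ δ γ∈Γ δ∈Γ ; ρ-eq = begin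
    upper s ⊗ (lower t ⊗ (γ ⊗ δ))  ≡⟨ transvect-⊗ s t γ δ ⟨
    transvect s t γ ⊗ δ            ≡⟨ cong (_⊗ δ) eq ⟩
    transvect s' t' γ' ⊗ δ         ≡⟨ transvect-⊗ s' t' γ' δ ⟩
    transvect s' t' (γ' ⊗ δ)       ≡⟨ cong (transvect s' t') γ'δ≡id ⟩
    transvect s' t' idM            ≡⟨ cong (upper s' ⊗_) (⊗-identityʳ (lower t')) ⟩
    upper s' ⊗ lower t'            ∎ }
    where open ≡-Reasoning

  first-index-≡ : ∀ {i i'} t t' {γ γ'} → i ≤ i' → i' < α → Γ γ ≡ true → Γ γ' ≡ true →
                  transvect [ i ] t γ ≡ transvect [ i' ] t' γ' → i ≡ i'
  first-index-≡ {i} {i'} t t' i≤i' i'<α γ∈Γ γ'∈Γ eq =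
    ≤-antisym i≤i' (m∸n≡0⇒m≤n (α-minimal {d} (≤-<-trans (m∸n≤m i' i) i'<α) d-annihilates))
    where
    open ≡-Reasoning
    open Quotient (quotient∈Γ [ i ] t [ i' ] t' γ∈Γ γ'∈Γ eq)

    d : ℕ
    d = i' ∸ i

    ρ-form : lower t ⊗ ρ ≡ upper [ d ] ⊗ lower t'
    ρ-form = ⊗-cancelˡ (upper-invertible [ i ]) (begin
      upper [ i ] ⊗ (lower t ⊗ ρ)             ≡⟨ ρ-eq ⟩
      upper [ i' ] ⊗ lower t'                 ≡⟨ cong (λ s → upper s ⊗ lower t') ([]-∸ i≤i') ⟩
      upper ([ i ] +ₙ [ d ]) ⊗ lower t'       ≡⟨ cong (_⊗ lower t') (upper-+ [ i ] [ d ]) ⟨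
      (upper [ i ] ⊗ upper [ d ]) ⊗ lower t'  ≡⟨ ⊗-assoc (upper [ i ]) (upper [ d ]) (lower t') ⟩
      upper [ i ] ⊗ (upper [ d ] ⊗ lower t')  ∎)

    d-annihilates : Annihilates W [ d * b ]
    d-annihilates w w∈W = subst (λ s → s ·V w ≡ zeroV) (sym ([]-* d b))
      (commutes-with-lower⇒annihilated ρ [ b ] [ d ] t t' w ρ-form
        (Γ-commute ρ (lower [ b ]) w ρ∈Γ lower-b∈Γ w∈W))

  second-index-≡ : ∀ s {j j' γ γ'} → j ≤ j' → j' < b → Γ γ ≡ true → Γ γ' ≡ true →
                   transvect s [ j ] γ ≡ transvect s [ j' ] γ' → j ≡ j'
  second-index-≡ s {j} {j'} j≤j' j'<b γ∈Γ γ'∈Γ eq =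
    ≤-antisym j≤j' (m∸n≡0⇒m≤n (b-minimal {e} (≤-<-trans (m∸n≤m j' j) j'<b)
                                             (subst (λ M → Γ M ≡ true) ρ-form ρ∈Γ)))
    where
    open ≡-Reasoning
    open Quotient (quotient∈Γ s [ j ] s [ j' ] γ∈Γ γ'∈Γ eq)

    e : ℕ
    e = j' ∸ j

    ρ-form : ρ ≡ lower [ e ]
    ρ-form = ⊗-cancelˡ (lower-invertible [ j ]) (⊗-cancelˡ (upper-invertible s) (begin
      upper s ⊗ (lower [ j ] ⊗ ρ)            ≡⟨ ρ-eq ⟩
      upper s ⊗ lower [ j' ]                 ≡⟨ cong (λ t → upper s ⊗ lower t) ([]-∸ j≤j') ⟩
      upper s ⊗ lower ([ j ] +ₙ [ e ])       ≡⟨ cong (upper s ⊗_) (lower-+ [ j ] [ e ]) ⟨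
      upper s ⊗ (lower [ j ] ⊗ lower [ e ])  ∎))

  transvect-injective : ∀ {i i' j j' γ γ'} → i < α → i' < α → j < b → j' < b → Γ γ ≡ true → Γ γ' ≡ true →
                        transvect [ i ] [ j ] γ ≡ transvect [ i' ] [ j' ] γ' → i ≡ i' × j ≡ j' × γ ≡ γ'
  transvect-injective {i} {i'} {j} {j'} {γ} {γ'} i<α i'<α j<b j'<b γ∈Γ γ'∈Γ eq = i≡i' , j≡j' , γ≡γ'
    where
    i≡i' : i ≡ i'
    i≡i' = [ (λ i≤i' → first-index-≡ [ j ] [ j' ] i≤i' i'<α γ∈Γ γ'∈Γ eq)
           , (λ i'≤i → sym (first-index-≡ [ j' ] [ j ] i'≤i i<α γ'∈Γ γ∈Γ (sym eq)))
           ]′ (≤-total i i')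

    eq₁ : transvect [ i ] [ j ] γ ≡ transvect [ i ] [ j' ] γ'
    eq₁ = subst (λ k → transvect [ i ] [ j ] γ ≡ transvect [ k ] [ j' ] γ') (sym i≡i') eq

    j≡j' : j ≡ j'
    j≡j' = [ (λ j≤j' → second-index-≡ [ i ] j≤j' j'<b γ∈Γ γ'∈Γ eq₁)
           , (λ j'≤j → sym (second-index-≡ [ i ] j'≤j j<b γ'∈Γ γ∈Γ (sym eq₁)))
           ]′ (≤-total j j')

    γ≡γ' : γ ≡ γ'
    γ≡γ' = ⊗-cancelˡ (lower-invertible [ j ]) (⊗-cancelˡ (upper-invertible [ i ])
             (subst (λ k → transvect [ i ] [ j ] γ ≡ transvect [ i ] [ k ] γ') (sym j≡j') eq₁))

  m*|Γ|≤|GL| : m * card (allMat n) Γ ≤ card (allMat n) isGL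
  m*|Γ|≤|GL| = subst (_≤ card (allMat n) isGL) length-representatives
    (injective⇒length≤ represent representatives-unique represent∈GL represent-injective)
    where
    indices : List (Fin α × Fin b)
    indices = cartesianProduct (allFin α) (allFin b)

    representatives : List ((Fin α × Fin b) × Mat n)
    representatives = cartesianProduct indices (filterᵇ Γ (allMat n))

    represent : (Fin α × Fin b) × Mat n → Mat n
    represent ((i , j) , γ) = transvect [ toℕ i ] [ toℕ j ] γ

    length-representatives : length representatives ≡ m * card (allMat n) Γ
    length-representatives = trans (length-cartesianProduct indices (filterᵇ Γ (allMat n)))
      (cong (_* card (allMat n) Γ) (trans (length-cartesianProduct (allFin α) (allFin b))
                                          (cong₂ _*_ (length-allFin α) (length-allFin b))))

    representatives-unique : Unique representatives
    representatives-unique = Unique.cartesianProduct⁺ (Unique.cartesianProduct⁺ (Unique.allFin⁺ α) (Unique.allFin⁺ b))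
                                                      (Unique.filter⁺ (T? ∘ Γ) allMat-unique)

    ∈Γ : ∀ {i j γ} → ((i , j) , γ) ∈ representatives → Γ γ ≡ true
    ∈Γ r∈ = ∈-filterᵇ⁻ Γ {xs = allMat n} (proj₂ (∈-cartesianProduct⁻ indices (filterᵇ Γ (allMat n)) r∈))

    represent∈GL : ∀ {r} → r ∈ representatives → represent r ∈ filterᵇ isGL (allMat n)
    represent∈GL {(i , j) , γ} r∈ =
      let γ' , _ , γγ'≡id , γ'γ≡id = Γ-inverse γ (∈Γ r∈)
      in ∈-filterᵇ⁺ isGL (∈-allMat _)
           (invertible⇒isGL (transvect-invertible [ toℕ i ] [ toℕ j ] (γ' , γγ'≡id , γ'γ≡id)))

    represent-injective : ∀ {r r'} → r ∈ representatives → r' ∈ representatives → represent r ≡ represent r' → r ≡ r'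
    represent-injective {(i , j) , γ} {(i' , j') , γ'} r∈ r'∈ eq =
      let i≡i' , j≡j' , γ≡γ' =
            transvect-injective (toℕ<n i) (toℕ<n i') (toℕ<n j) (toℕ<n j') (∈Γ r∈) (∈Γ r'∈) eq
      in cong₂ _,_ (cong₂ _,_ (toℕ-injective i≡i') (toℕ-injective j≡j')) γ≡γ'

  |W|≤m*m : card (allV n) W ≤ m * m
  |W|≤m*m = subst (card (allV n) W ≤_) (trans (length-cartesianProduct (allFin m) (allFin m))
                                              (cong₂ _*_ (length-allFin m) (length-allFin m)))
    (injective⇒length≤ code (Unique.filter⁺ (T? ∘ W) allV-unique) code∈ code-injective)
    where
    code : V n → Fin m × Fin m
    code (x , y) = kernel-code m x , kernel-code m y

    code∈ : ∀ {w} → w ∈ filterᵇ W (allV n) → code w ∈ cartesianProduct (allFin m) (allFin m)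
    code∈ _ = ∈-cartesianProduct⁺ (∈-allFin _) (∈-allFin _)

    annihilated : ∀ {w} → w ∈ filterᵇ W (allV n) → [ m ] ·V w ≡ zeroV
    annihilated {w} w∈ = αb-annihilates w (∈-filterᵇ⁻ W {xs = allV n} w∈)

    code-injective : ∀ {w w'} → w ∈ filterᵇ W (allV n) → w' ∈ filterᵇ W (allV n) → code w ≡ code w' → w ≡ w'
    code-injective w∈ w'∈ eq = cong₂ _,_
      (kernel-code-injective m (cong proj₁ (annihilated w∈)) (cong proj₁ (annihilated w'∈)) (cong proj₁ eq))
      (kernel-code-injective m (cong proj₂ (annihilated w∈)) (cong proj₂ (annihilated w'∈)) (cong proj₂ eq))

  |Γ|>0 : 0 < card (allMat n) Γ
  |Γ|>0 = ∈-length (∈-filterᵇ⁺ Γ (∈-allMat idM) Γ-id)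

proposition9 : (n : ℕ) → {{_ : NonZero n}}
    → (Γ : Mat n → Bool)
    → (∀ g → Γ g ≡ true → isGL g ≡ true)
    → Γ idM ≡ true
    → (∀ g h → Γ g ≡ true → Γ h ≡ true → Γ (g ⊗ h) ≡ true)
    → (∀ g → Γ g ≡ true → Σ (Mat n) (λ g' → (Γ g' ≡ true) × ((g ⊗ g') ≡ idM) × ((g' ⊗ g) ≡ idM)))
    → (W : V n → Bool)
    → W zeroV ≡ true
    → (∀ v w → W v ≡ true → W w ≡ true → W (v +V w) ≡ true)
    → (∀ s w → W w ≡ true → W (s ·V w) ≡ true)
    → (∀ g w → Γ g ≡ true → W w ≡ true → W (g ⊙ w) ≡ true)
    → (∀ g h w → Γ g ≡ true → Γ h ≡ true → W w ≡ true → g ⊙ (h ⊙ w) ≡ h ⊙ (g ⊙ w))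
    → card (allV n) W ≤ indexℕ (card (allMat n) isGL) (card (allMat n) Γ) ^ 3
proposition9 n Γ _ Γ-id Γ-⊗ Γ-inverse W _ _ _ _ Γ-commute = begin
  card (allV n) W                                        ≤⟨ |W|≤m*m ⟩
  m * m                                                  ≤⟨ k*k≤k^3 m ⟩
  m ^ 3                                                  ≤⟨ ^-monoˡ-≤ 3 (≤-indexℕ m m*|Γ|≤|GL| |Γ|>0) ⟩
  indexℕ (card (allMat n) isGL) (card (allMat n) Γ) ^ 3  ∎
  where
  open ≤-Reasoning

  least-lower : LeastPositive (λ j → Γ (lower [ j ]) ≡ true)
  least-lower = least-lower∈Γ Γ Γ-id

  open Transvections Γ Γ-id Γ-⊗ Γ-inverse W Γ-commute
    least-lower (least-annihilator W (LeastPositive.value least-lower))
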